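{- Let $(G,Z,k)$ be an instance of Disjoint $d$-quasi-forest deletion in which there are $k+d+3$ connected components $T_1,\dots,T_{k+d+3}$ of $G - Z$ that are trees and all have the same neighborhood type in $Z$. Let $G'$ be obtained from $G$ by deleting the vertices of $T_{k+d+3}$. Then $(G,Z,k)$ is a yes-instance if and only if $(G',Z,k)$ is a yes-instance.
   Context: A $d$-quasi-forest is a graph in which each connected component admits a feedback vertex set of size at most $d$. Disjoint $d$-quasi-forest deletion: the input is a graph $G$, an integer $k$, and a set $Z \subseteq V(G)$ with $|Z| \le k+1$ such that $G - Z$ is a $d$-quasi-forest ($d$ fixed); it is a yes-instance iff there is $X \subseteq V(G)$ with $|X| \le k$ and $X \cap Z = \emptyset$ such that $G - X$ is a $d$-quasi-forest. For a subgraph $T$ of $G - Z$, $N_Z(T)$ is the set of vertices of $Z$ adjacent to some vertex of $T$. Two trees $T_1,T_2$ in $G-Z$ have the same neighborhood type in $Z$ if $N_Z(T_1)=N_Z(T_2)$ and, for every $u \in N_Z(T_1)$, $u$ has exactly one edge to $T_1$ if and only if $u$ has exactly one edge to $T_2$. -}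

module Defs where

open import Data.Nat using (ℕ; zero; suc; _+_; _≤_)
open import Data.Bool using (Bool; true; false)
open import Data.Fin using (Fin)
open import Data.Fin.Subset using (Subset; _∈_; _∉_; _⊆_; _∩_; ∁; _─_; ∣_∣; Nonempty)
open import Data.Vec using (tabulate)
open import Data.List using (List; []; _∷_; _∷ʳ_; length)
open import Data.List.Relation.Unary.All using (All)
open import Data.List.Relation.Unary.Unique.Propositional using (Unique)
open import Data.Product using (Σ; ∃; _×_)
open import Data.Unit using (⊤)
open import Relation.Binary.PropositionalEquality using (_≡_)
open import Relation.Nullary using (¬_)
open import Function.Bundles using (_⇔_)

record Graph (n : ℕ) : Set where
  field
    adj    : Fin n → Fin n → Bool
    sym    : ∀ u v → adj u v ≡ adj v u
    irrefl : ∀ u → adj u u ≡ false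
open Graph public

-- Throughout, a subgraph is the subgraph of G induced by an "active" vertex set S.

data Walk {n : ℕ} (G : Graph n) (S : Subset n) : Fin n → Fin n → Set where
  here : ∀ {u} → u ∈ S → Walk G S u u
  step : ∀ {u w v} → u ∈ S → adj G u w ≡ true → Walk G S w v → Walk G S u v

Connected : ∀ {n} → Graph n → Subset n → Set
Connected G C = ∀ u v → u ∈ C → v ∈ C → Walk G C u v

IsComponent : ∀ {n} → Graph n → Subset n → Subset n → Set
IsComponent G S C =
  C ⊆ S × Nonempty C × Connected G C ×
  (∀ u w → u ∈ C → w ∈ S → adj G u w ≡ true → w ∈ C)

Chain : ∀ {n} → Graph n → Fin n → List (Fin n) → Set
Chain G u []       = ⊤
Chain G u (w ∷ ws) = adj G u w ≡ true × Chain G w ws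

HasCycle : ∀ {n} → Graph n → Subset n → Set
HasCycle G S = Σ _ λ v → Σ (List _) λ ws →
  2 ≤ length ws × Unique (v ∷ ws) × All (_∈ S) (v ∷ ws) × Chain G v (ws ∷ʳ v)

IsTree : ∀ {n} → Graph n → Subset n → Set
IsTree G C = Nonempty C × Connected G C × ¬ HasCycle G C

IsFVS : ∀ {n} → Graph n → Subset n → Subset n → Set
IsFVS G C F = F ⊆ C × ¬ HasCycle G (C ─ F)

QuasiForest : ∀ {n} → ℕ → Graph n → Subset n → Set
QuasiForest d G S = ∀ C → IsComponent G S C → Σ _ λ F → IsFVS G C F × ∣ F ∣ ≤ d

YesInstance : ∀ {n} → ℕ → Graph n → Subset n → Subset n → ℕ → Set
YesInstance d G S Z k =
  Σ _ λ X → X ⊆ S × ∣ X ∣ ≤ k × (∀ x → x ∈ X → x ∉ Z) × QuasiForest d G (S ─ X)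

IsInstance : ∀ {n} → ℕ → Graph n → Subset n → Subset n → ℕ → Set
IsInstance d G S Z k = Z ⊆ S × ∣ Z ∣ ≤ suc k × QuasiForest d G (S ─ Z)

HasNbrIn : ∀ {n} → Graph n → Fin n → Subset n → Set
HasNbrIn G u T = ∃ λ v → v ∈ T × adj G u v ≡ true

edgesTo : ∀ {n} → Graph n → Fin n → Subset n → ℕ
edgesTo G u T = ∣ T ∩ tabulate (adj G u) ∣

SameNbhdType : ∀ {n} → Graph n → Subset n → Subset n → Subset n → Set
SameNbhdType G Z T₁ T₂ =
  (∀ u → u ∈ Z → (HasNbrIn G u T₁ ⇔ HasNbrIn G u T₂)) ×
  (∀ u → u ∈ Z → HasNbrIn G u T₁ → (edgesTo G u T₁ ≡ 1 ⇔ edgesTo G u T₂ ≡ 1))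

module Submission where

-- (⇒) Quasi-forests are hereditary, so a solution X of G gives the solution X − L of G − L.
-- (⇐) Let X solve G − L and let C be a component of G − X meeting L. If no vertex of Z
-- sees L, then C = L is a tree. Otherwise some u₀ ∈ Z sees L; let C′ be the component of
-- G − L − X containing u₀ and F′ a feedback vertex set of it with ∣ F′ ∣ ≤ d. The other
-- k + d + 2 trees are disjoint and ∣ X ∪ F′ ∣ ≤ k + d, so two of them avoid X ∪ F′; both
-- hang off u₀ inside C′ − F′. A vertex of Z seeing L sees both, so two such vertices
-- outside F′ would close a cycle through the two trees, and one with two edges to L has
-- two edges to a tree, again a cycle. Hence at most one edge of C − F′ leaves the tree L,
-- so every cycle of C − F′ avoids L (lemma cycle-avoids) and lies in C′ − F′.

open import Defs
open import Data.Nat using (ℕ; _+_)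
open import Data.Fin using (Fin; fromℕ)
open import Data.Fin.Subset using (Subset; ⊤; ∁; _─_)
open import Function.Definitions using (Injective)
open import Function.Bundles using (_⇔_)
open import Relation.Binary.PropositionalEquality using (_≡_)

open import Data.Nat using (zero; suc; _≤_; _<_; z≤n; s≤s)
import Data.Nat.Properties as ℕ
open import Data.Bool using (Bool; true)
open import Data.Bool.Properties using () renaming (_≟_ to _≟ᵇ_)
open import Data.Fin using (zero; suc; inject₁)
open import Data.Fin.Properties using (any?; suc-injective; fromℕ≢inject₁; inject₁-injective)
  renaming (_≟_ to _≟ᶠ_)
open import Data.Fin.Subset using (_∈_; _∉_; _⊆_; _∩_; _∪_; _-_; ⁅_⁆; ∣_∣; inside; outside)
  renaming (⊥ to ∅)
open import Data.Fin.Subset.Properties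
  using (_∈?_; ∈⊤; ∉⊥; x∈⁅x⁆; x∈⁅y⁆⇒x≡y; x∉⁅y⁆⇒x≢y; ∣⁅x⁆∣≡1; ∣⊥∣≡0; nonempty?;
         x∈p∧x∉q⇒x∈p─q; x∈p∧x≢y⇒x∈p-y; x∈p⇒∣p-x∣<∣p∣; p─q⊆p; ∣p─q∣≤∣p∣; ∣p∣≤n;
         x∈p∩q⁺; x∈p∩q⁻; ∣p∩q∣≤∣p∣; x∈p∪q⁺; p⊂q⇒∣p∣<∣q∣; p⊆q⇒∣p∣≤∣q∣;
         ⊆-antisym; x∈∁p⇒x∉p; x∉p⇒x∈∁p)
open import Data.Vec.Base using (tabulate; []; _∷_; here; there)
open import Data.Vec.Properties using (lookup∘tabulate; []=⇒lookup; lookup⇒[]=)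
open import Data.List using (List; []; _∷_; _∷ʳ_; _++_; length; map)
open import Data.List.Relation.Unary.All as All using (All; []; _∷_)
open import Data.List.Relation.Unary.Unique.Propositional using (Unique)
open import Data.List.Properties using (++-assoc; length-map)
open import Data.List.Relation.Unary.Any as Any using (Any; here; there)
import Data.List.Relation.Unary.All.Properties as All
import Data.List.Relation.Unary.Any.Properties as Any
open import Data.List.Membership.Propositional using (find; lose) renaming (_∈_ to _∈ₗ_; _∉_ to _∉ₗ_)
open import Data.List.Membership.Propositional.Properties using (∈-∃++; ∈-++⁻)
import Data.List.Relation.Unary.Unique.Propositional.Properties as Unique
open import Data.List.Relation.Binary.Permutation.Propositional using (_↭_; ↭⇒↭ₛ)
open import Data.List.Relation.Binary.Permutation.Propositional.Properties using (++-comm; All-resp-↭; ∈-resp-↭; ↭-length)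
open import Data.List.Relation.Unary.AllPairs using ([]; _∷_)
open import Data.Unit using (tt)
open import Data.Product using (Σ; ∃; _×_; _,_; proj₁; proj₂)
open import Data.Sum using (_⊎_; inj₁; inj₂)
open import Relation.Nullary using (¬_; Dec; yes; no; does; contradiction)
open import Relation.Nullary.Decidable using (_×-dec_; _⊎-dec_; ¬?; dec-true)
open import Relation.Unary using (Decidable)
open import Function.Base using (_∘′_)
open import Function.Bundles using (mk⇔; Equivalence)
open import Relation.Binary.PropositionalEquality using (refl; trans; subst; _≢_; setoid)
  renaming (sym to ≡-sym)

-- Finite subsets: membership and size

Disjoint : ∀ {n} → Subset n → Subset n → Set
Disjoint P Q = ∀ {x} → x ∈ P → x ∉ Q

x∈p─q⁻ : ∀ {n} (p q : Subset n) {x} → x ∈ p ─ q → x ∈ p × x ∉ q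
x∈p─q⁻ p q m = p─q⊆p p q m , x∉q p q m
  where
  x∉q : ∀ {n} (p q : Subset n) {x} → x ∈ p ─ q → x ∉ q
  x∉q (_ ∷ p) (inside  ∷ q) {zero}  ()
  x∉q (_ ∷ p) (outside ∷ q) {zero}  _         ()
  x∉q (_ ∷ p) (inside  ∷ q) {suc x} (there m) (there x∈q) = x∉q p q m x∈q
  x∉q (_ ∷ p) (outside ∷ q) {suc x} (there m) (there x∈q) = x∉q p q m x∈q

∈-tabulate⁺ : ∀ {n} (f : Fin n → Bool) {x} → f x ≡ true → x ∈ tabulate f
∈-tabulate⁺ f {x} fx≡true = lookup⇒[]= x _ (trans (lookup∘tabulate f x) fx≡true)

∈-tabulate⁻ : ∀ {n} (f : Fin n → Bool) {x} → x ∈ tabulate f → f x ≡ true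
∈-tabulate⁻ f {x} x∈ = trans (≡-sym (lookup∘tabulate f x)) ([]=⇒lookup x∈)

select : ∀ {n} {P : Fin n → Set} → Decidable P → Subset n
select P? = tabulate (λ x → does (P? x))

∈-select⁺ : ∀ {n} {P : Fin n → Set} (P? : Decidable P) {x} → P x → x ∈ select P?
∈-select⁺ P? {x} px = ∈-tabulate⁺ _ (dec-true (P? x) px)

∈-select⁻ : ∀ {n} {P : Fin n → Set} (P? : Decidable P) {x} → x ∈ select P? → P x
∈-select⁻ P? {x} x∈ = from-does (P? x) (∈-tabulate⁻ _ x∈)
  where
  from-does : ∀ {A : Set} (a? : Dec A) → does a? ≡ true → A
  from-does (yes a) _ = a

∣p∪q∣≤∣p∣+∣q∣ : ∀ {n} (p q : Subset n) → ∣ p ∪ q ∣ ≤ ∣ p ∣ + ∣ q ∣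
∣p∪q∣≤∣p∣+∣q∣ []            []            = z≤n
∣p∪q∣≤∣p∣+∣q∣ (inside  ∷ p) (inside  ∷ q) = s≤s (ℕ.≤-trans (∣p∪q∣≤∣p∣+∣q∣ p q) (ℕ.+-monoʳ-≤ ∣ p ∣ (ℕ.n≤1+n ∣ q ∣)))
∣p∪q∣≤∣p∣+∣q∣ (inside  ∷ p) (outside ∷ q) = s≤s (∣p∪q∣≤∣p∣+∣q∣ p q)
∣p∪q∣≤∣p∣+∣q∣ (outside ∷ p) (inside  ∷ q) = ℕ.≤-trans (s≤s (∣p∪q∣≤∣p∣+∣q∣ p q)) (ℕ.≤-reflexive (≡-sym (ℕ.+-suc _ _)))
∣p∪q∣≤∣p∣+∣q∣ (outside ∷ p) (outside ∷ q) = ∣p∪q∣≤∣p∣+∣q∣ p q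

x∈p⇒∣p∣>0 : ∀ {n} {p : Subset n} {x} → x ∈ p → 0 < ∣ p ∣
x∈p⇒∣p∣>0 x∈p = ℕ.≤-<-trans z≤n (x∈p⇒∣p-x∣<∣p∣ x∈p)

∣p∣≡1⇒x≡y : ∀ {n} {p : Subset n} {x y} → ∣ p ∣ ≡ 1 → x ∈ p → y ∈ p → x ≡ y
∣p∣≡1⇒x≡y {x = x} {y} ∣p∣≡1 x∈p y∈p with x ≟ᶠ y
... | yes x≡y = x≡y
... | no  x≢y = contradiction (subst (1 <_) ∣p∣≡1 two≤∣p∣) (ℕ.<-irrefl refl)
  where
  two≤∣p∣ = ℕ.≤-trans (s≤s (x∈p⇒∣p∣>0 (x∈p∧x≢y⇒x∈p-y y∈p (x≢y ∘′ ≡-sym)))) (x∈p⇒∣p-x∣<∣p∣ x∈p)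

∣p∣≢1⇒another : ∀ {n} {p : Subset n} {x} → x ∈ p → ∣ p ∣ ≢ 1 → ∃ λ y → y ∈ p × y ≢ x
∣p∣≢1⇒another {p = p} {x} x∈p ∣p∣≢1 with nonempty? (p - x)
... | yes (y , y∈p-x) = y , proj₁ (x∈p─q⁻ p _ y∈p-x) , x∉⁅y⁆⇒x≢y (proj₂ (x∈p─q⁻ p _ y∈p-x))
... | no  p-x-empty = contradiction (ℕ.≤-antisym ∣p∣≤1 (x∈p⇒∣p∣>0 x∈p)) ∣p∣≢1
  where
  p⊆⁅x⁆ : p ⊆ ⁅ x ⁆
  p⊆⁅x⁆ {y} y∈p with y ≟ᶠ x
  ... | yes refl = x∈⁅x⁆ x
  ... | no  y≢x  = contradiction (y , x∈p∧x≢y⇒x∈p-y y∈p y≢x) p-x-empty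
  ∣p∣≤1 : ∣ p ∣ ≤ 1
  ∣p∣≤1 = ℕ.≤-trans (p⊆q⇒∣p∣≤∣q∣ p⊆⁅x⁆) (ℕ.≤-reflexive (∣⁅x⁆∣≡1 x))

-- Walks and components
module _ {n : ℕ} (G : Graph n) where

  adj-sym : ∀ {u v} → adj G u v ≡ true → adj G v u ≡ true
  adj-sym {u} {v} e = trans (Graph.sym G v u) e

  hasNbr? : ∀ u (P : Subset n) → Dec (HasNbrIn G u P)
  hasNbr? u P = any? (λ v → (v ∈? P) ×-dec (adj G u v ≟ᵇ true))

  ∈-neighbours⁺ : ∀ {u T x} → x ∈ T → adj G u x ≡ true → x ∈ T ∩ tabulate (adj G u)
  ∈-neighbours⁺ {u} x∈T u~x = x∈p∩q⁺ (x∈T , ∈-tabulate⁺ (adj G u) u~x)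

  ∈-neighbours⁻ : ∀ {u T x} → x ∈ T ∩ tabulate (adj G u) → x ∈ T × adj G u x ≡ true
  ∈-neighbours⁻ {u} {T} x∈ with x∈p∩q⁻ T _ x∈
  ... | x∈T , x∈nbrs = x∈T , ∈-tabulate⁻ (adj G u) x∈nbrs

  one-edge⇒one-neighbour : ∀ {u T x x′} → edgesTo G u T ≡ 1 → x ∈ T → x′ ∈ T →
    adj G u x ≡ true → adj G u x′ ≡ true → x ≡ x′
  one-edge⇒one-neighbour one x∈T x′∈T u~x u~x′ =
    ∣p∣≡1⇒x≡y one (∈-neighbours⁺ x∈T u~x) (∈-neighbours⁺ x′∈T u~x′)

  another-neighbour : ∀ {u T x} → x ∈ T → adj G u x ≡ true → edgesTo G u T ≢ 1 →
    ∃ λ x′ → (x′ ∈ T × adj G u x′ ≡ true) × x′ ≢ x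
  another-neighbour x∈T u~x not-one with ∣p∣≢1⇒another (∈-neighbours⁺ x∈T u~x) not-one
  ... | x′ , x′∈ , x′≢x = x′ , ∈-neighbours⁻ x′∈ , x′≢x

  walk-mono : ∀ {S S′} → S ⊆ S′ → ∀ {u v} → Walk G S u v → Walk G S′ u v
  walk-mono S⊆S′ (here u∈S)        = here (S⊆S′ u∈S)
  walk-mono S⊆S′ (step u∈S e walk) = step (S⊆S′ u∈S) e (walk-mono S⊆S′ walk)

  walk-start : ∀ {S u v} → Walk G S u v → u ∈ S
  walk-start (here u∈S)     = u∈S
  walk-start (step u∈S _ _) = u∈S

  walk-++ : ∀ {S u v w} → Walk G S u v → Walk G S v w → Walk G S u w
  walk-++ (here _)          walk′ = walk′
  walk-++ (step u∈S e walk) walk′ = step u∈S e (walk-++ walk walk′)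

  walk-reverse : ∀ {S u v} → Walk G S u v → Walk G S v u
  walk-reverse (here u∈S)        = here u∈S
  walk-reverse (step u∈S e walk) =
    walk-++ (walk-reverse walk) (step (walk-start walk) (adj-sym e) (here u∈S))

  component-⊆ : ∀ {A C} → IsComponent G A C → C ⊆ A
  component-⊆ (C⊆A , _ , _ , _) = C⊆A

  component-connected : ∀ {A C} → IsComponent G A C → Connected G C
  component-connected (_ , _ , connected , _) = connected

  component-closed : ∀ {A C} → IsComponent G A C →
    ∀ {u w} → u ∈ C → w ∈ A → adj G u w ≡ true → w ∈ C
  component-closed (_ , _ , _ , closed) u∈C w∈A e = closed _ _ u∈C w∈A e

  walk-in-component : ∀ {A B C} → IsComponent G A C → B ⊆ A →
    ∀ {t v} → t ∈ C → Walk G B t v → v ∈ C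
  walk-in-component C-comp B⊆A t∈C (here _)        = t∈C
  walk-in-component C-comp B⊆A t∈C (step _ e walk) =
    walk-in-component C-comp B⊆A (component-closed C-comp t∈C (B⊆A (walk-start walk)) e) walk

  component-⊆-component : ∀ {A C₁ C₂ x} → IsComponent G A C₁ → IsComponent G A C₂ →
    x ∈ C₁ → x ∈ C₂ → C₁ ⊆ C₂
  component-⊆-component {x = x} C₁-comp C₂-comp x∈C₁ x∈C₂ {y} y∈C₁ =
    walk-in-component C₂-comp (component-⊆ C₁-comp) x∈C₂ (component-connected C₁-comp x y x∈C₁ y∈C₁)

  -- Breadth-first exploration of G[A]: every vertex of A lies in a component of G[A].
  module Exploration (A : Subset n) where

    Grows : Subset n → Fin n → Set
    Grows R v = v ∈ R ⊎ (v ∈ A × HasNbrIn G v R)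

    grows? : ∀ R → Decidable (Grows R)
    grows? R v = (v ∈? R) ⊎-dec ((v ∈? A) ×-dec hasNbr? v R)

    grow : Subset n → Subset n
    grow R = select (grows? R)

    R⊆grow : ∀ {R} → R ⊆ grow R
    R⊆grow {R} m = ∈-select⁺ (grows? R) (inj₁ m)

    Closed : Subset n → Set
    Closed R = ∀ {u v} → u ∈ R → v ∈ A → adj G u v ≡ true → v ∈ R

    NewVertex : Subset n → Set
    NewVertex R = ∃ λ v → v ∈ grow R × v ∉ R

    new? : ∀ R → Dec (NewVertex R)
    new? R = any? (λ v → (v ∈? grow R) ×-dec ¬? (v ∈? R))

    no-new⇒closed : ∀ {R} → ¬ NewVertex R → Closed R
    no-new⇒closed {R} none {u} {v} u∈R v∈A e with v ∈? R
    ... | yes v∈R = v∈R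
    ... | no  v∉R = contradiction (v , ∈-select⁺ (grows? R) (inj₂ (v∈A , u , u∈R , adj-sym e)) , v∉R) none

    Reached : Fin n → Subset n → Set
    Reached c R = c ∈ R × R ⊆ A × (∀ {v} → v ∈ R → Walk G R c v)

    grow-reached : ∀ {c R} → Reached c R → Reached c (grow R)
    grow-reached {c} {R} (c∈R , R⊆A , reach) = R⊆grow c∈R , grow⊆A , reach′
      where
      grow⊆A : grow R ⊆ A
      grow⊆A m with ∈-select⁻ (grows? R) m
      ... | inj₁ v∈R       = R⊆A v∈R
      ... | inj₂ (v∈A , _) = v∈A
      reach′ : ∀ {v} → v ∈ grow R → Walk G (grow R) c v
      reach′ m with ∈-select⁻ (grows? R) m
      ... | inj₁ v∈R                  = walk-mono R⊆grow (reach v∈R)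
      ... | inj₂ (_ , u , u∈R , v~u) =
        walk-++ (walk-mono R⊆grow (reach u∈R)) (step (R⊆grow u∈R) (adj-sym v~u) (here m))

    explore : ℕ → Subset n → Subset n
    explore zero    R = R
    explore (suc f) R with new? R
    ... | yes _ = explore f (grow R)
    ... | no  _ = R

    explore-reached : ∀ {c} f R → Reached c R → Reached c (explore f R)
    explore-reached zero    R r = r
    explore-reached (suc f) R r with new? R
    ... | yes _ = explore-reached f (grow R) (grow-reached r)
    ... | no  _ = r

    -- Each productive round enlarges R, so n rounds reach a closed set.
    larger : ∀ {R} → NewVertex R → ∣ R ∣ < ∣ grow R ∣
    larger new = p⊂q⇒∣p∣<∣q∣ (R⊆grow , new)

    explore-closed : ∀ f R → n ≤ f + ∣ R ∣ → Closed (explore f R)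
    explore-closed zero R n≤∣R∣ with new? R
    ... | yes new  = contradiction (ℕ.<-≤-trans (larger new) (ℕ.≤-trans (∣p∣≤n (grow R)) n≤∣R∣)) (ℕ.<-irrefl refl)
    ... | no  none = no-new⇒closed none
    explore-closed (suc f) R n≤f+∣R∣ with new? R
    ... | yes new  = explore-closed f (grow R)
                       (ℕ.≤-trans n≤f+∣R∣ (ℕ.≤-trans (ℕ.≤-reflexive (≡-sym (ℕ.+-suc f _))) (ℕ.+-monoʳ-≤ f (larger new))))
    ... | no  none = no-new⇒closed none

    component-of : ∀ c → c ∈ A → Σ (Subset n) λ C → IsComponent G A C × c ∈ C
    component-of c c∈A = C , (C⊆A , (c , c∈C) , connected , λ _ _ → closed) , c∈C
      where
      C = explore n ⁅ c ⁆
      start : Reached c ⁅ c ⁆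
      start = x∈⁅x⁆ c , (λ m → subst (_∈ A) (≡-sym (x∈⁅y⁆⇒x≡y c m)) c∈A)
                      , (λ m → subst (Walk G ⁅ c ⁆ c) (≡-sym (x∈⁅y⁆⇒x≡y c m)) (here (x∈⁅x⁆ c)))
      reached = explore-reached n ⁅ c ⁆ start
      c∈C = proj₁ reached
      C⊆A = proj₁ (proj₂ reached)
      connected : Connected G C
      connected u v u∈C v∈C = walk-++ (walk-reverse (proj₂ (proj₂ reached) u∈C)) (proj₂ (proj₂ reached) v∈C)
      closed = explore-closed n ⁅ c ⁆ (ℕ.m≤m+n n _)

  open Exploration public using (component-of)

  Cycle : Subset n → Fin n → List (Fin n) → Set
  Cycle S v ws = 2 ≤ length ws × Unique (v ∷ ws) × All (_∈ S) (v ∷ ws) × Chain G v (ws ∷ʳ v)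

  hasCycle-mono : ∀ {S S′} → S ⊆ S′ → HasCycle G S → HasCycle G S′
  hasCycle-mono S⊆S′ (v , ws , long , distinct , inS , chain) =
    v , ws , long , distinct , All.map S⊆S′ inS , chain

  -- Quasi-forests are hereditary: a component of G[B] lies in a component of G[A],
  -- and a feedback vertex set of the latter restricts to one of the former.
  quasiForest-mono : ∀ {d A B} → B ⊆ A → QuasiForest d G A → QuasiForest d G B
  quasiForest-mono {A = A} B⊆A qf C C-comp@(C⊆B , (c , c∈C) , connected , _) =
    F ∩ C , ((λ m → proj₂ (x∈p∩q⁻ F C m)) , acyclic) , ℕ.≤-trans (∣p∩q∣≤∣p∣ F C) ∣F∣≤d
    where
    C⊆A : C ⊆ A
    C⊆A m = B⊆A (C⊆B m)
    enclosing = component-of A c (C⊆A c∈C)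
    C′ = proj₁ enclosing
    C′-comp = proj₁ (proj₂ enclosing)
    C⊆C′ : C ⊆ C′
    C⊆C′ {v} v∈C = walk-in-component C′-comp C⊆A (proj₂ (proj₂ enclosing)) (connected c v c∈C v∈C)
    F = proj₁ (qf C′ C′-comp)
    ∣F∣≤d = proj₂ (proj₂ (qf C′ C′-comp))
    C─F∩C⊆C′─F : C ─ (F ∩ C) ⊆ C′ ─ F
    C─F∩C⊆C′─F m with x∈p─q⁻ C _ m
    ... | v∈C , v∉F∩C = x∈p∧x∉q⇒x∈p─q (C⊆C′ v∈C) (λ v∈F → v∉F∩C (x∈p∩q⁺ (v∈F , v∈C)))
    acyclic : ¬ HasCycle G (C ─ (F ∩ C))
    acyclic cycle = proj₂ (proj₁ (proj₂ (qf C′ C′-comp))) (hasCycle-mono C─F∩C⊆C′─F cycle)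

-- Simple paths and cycles
module _ {n : ℕ} (G : Graph n) where
  open import Data.List.Membership.DecPropositional (_≟ᶠ_ {n}) using () renaming (_∈?_ to _∈ₗ?_)
  open import Data.List.Relation.Binary.Permutation.Setoid.Properties (setoid (Fin n))
    using (Unique-resp-↭)

  endpoint : Fin n → List (Fin n) → Fin n
  endpoint u []       = u
  endpoint u (x ∷ xs) = endpoint x xs

  endpoint-∈ : ∀ u x xs → endpoint u (x ∷ xs) ∈ₗ x ∷ xs
  endpoint-∈ u x []       = here refl
  endpoint-∈ u x (y ∷ xs) = there (endpoint-∈ x y xs)

  endpoint-++ : ∀ u xs ys → endpoint u (xs ++ ys) ≡ endpoint (endpoint u xs) ys
  endpoint-++ u []       ys = refl
  endpoint-++ u (x ∷ xs) ys = endpoint-++ x xs ys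

  chain-++⁺ : ∀ u xs {ys} → Chain G u xs → Chain G (endpoint u xs) ys → Chain G u (xs ++ ys)
  chain-++⁺ u []       _          rest = rest
  chain-++⁺ u (x ∷ xs) (e , chain) rest = e , chain-++⁺ x xs chain rest

  chain-++⁻ : ∀ u xs {ys} → Chain G u (xs ++ ys) → Chain G u xs × Chain G (endpoint u xs) ys
  chain-++⁻ u []       chain       = tt , chain
  chain-++⁻ u (x ∷ xs) (e , chain) = let (front , back) = chain-++⁻ x xs chain in (e , front) , back

  Path : Subset n → Fin n → Fin n → List (Fin n) → Set
  Path S x y ps = Chain G x ps × Unique (x ∷ ps) × All (_∈ S) (x ∷ ps) × endpoint x ps ≡ y

  path-mono : ∀ {S S′ x y ps} → S ⊆ S′ → Path S x y ps → Path S′ x y ps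
  path-mono S⊆S′ (chain , distinct , inS , end) = chain , distinct , All.map S⊆S′ inS , end

  path-cons : ∀ {S w x y ps} → w ∈ S → adj G w x ≡ true → w ∉ₗ x ∷ ps →
    Path S x y ps → Path S w y (x ∷ ps)
  path-cons w∈S e w∉ (chain , distinct , inS , end) =
    (e , chain) , All.¬Any⇒All¬ _ w∉ ∷ distinct , w∈S ∷ inS , end

  path-join : ∀ {S x y x′ y′ ps qs} → Path S x y ps → adj G y x′ ≡ true → Path S x′ y′ qs →
    (∀ {v} → v ∈ₗ x ∷ ps → v ∉ₗ x′ ∷ qs) → Path S x y′ (ps ++ x′ ∷ qs)
  path-join {x = x} {ps = ps} (chain , distinct , inS , refl) e (chain′ , distinct′ , inS′ , refl) apart =
    chain-++⁺ x ps chain (e , chain′) ,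
    Unique.++⁺ distinct distinct′ (λ (v∈ , v∈′) → apart v∈ v∈′) ,
    All.++⁺ inS inS′ ,
    endpoint-++ x ps _

  path-close : ∀ {S x y ps} → Path S x y ps → 2 ≤ length ps → adj G y x ≡ true → HasCycle G S
  path-close {x = x} {ps = ps} (chain , distinct , inS , refl) long e =
    x , ps , long , distinct , inS , chain-++⁺ x ps chain (e , tt)

  suffix : ∀ {S x y u} ps → u ∈ₗ x ∷ ps → Path S x y ps → Σ (List (Fin n)) (Path S u y)
  suffix ps       (here refl) path = ps , path
  suffix (p ∷ ps) (there u∈)  ((_ , chain) , (_ ∷ distinct) , (_ ∷ inS) , end) =
    suffix ps u∈ (chain , distinct , inS , end)

  walk→path : ∀ {S x y} → Walk G S x y → Σ (List (Fin n)) (Path S x y)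
  walk→path (here x∈S) = [] , tt , (All.[] ∷ []) , (x∈S ∷ []) , refl
  walk→path {x = x} (step {w = w} x∈S e walk) with walk→path walk
  ... | ps , path with x ∈ₗ? w ∷ ps
  ...   | yes x∈ = suffix ps x∈ path
  ...   | no  x∉ = w ∷ ps , path-cons x∈S e x∉ path

  ∉-outside : ∀ {T : Subset n} {w xs} → w ∉ T → All (_∈ T) xs → w ∉ₗ xs
  ∉-outside w∉T inT w∈ = w∉T (All.lookup inT w∈)

  cycle-through-vertex : ∀ {S T w x x′} → T ⊆ S → Connected G T → w ∈ S → w ∉ T →
    x ∈ T → x′ ∈ T → x ≢ x′ → adj G w x ≡ true → adj G w x′ ≡ true → HasCycle G S
  cycle-through-vertex {x = x} {x′} T⊆S connected w∈S w∉T x∈T x′∈T x≢x′ w~x w~x′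
    with walk→path (connected x x′ x∈T x′∈T)
  ... | [] , (_ , _ , _ , x≡x′) = contradiction x≡x′ x≢x′
  ... | _ ∷ _ , path@(_ , _ , inT , _) =
    path-close (path-cons w∈S w~x (∉-outside w∉T inT) (path-mono T⊆S path)) (s≤s (s≤s z≤n)) (adj-sym G w~x′)

  cycle-through-two-sets : ∀ {S T₁ T₂ z z′} → T₁ ⊆ S → T₂ ⊆ S →
    Connected G T₁ → Connected G T₂ → Disjoint T₁ T₂ →
    z ∈ S → z′ ∈ S → z ≢ z′ → z ∉ T₁ → z ∉ T₂ → z′ ∉ T₁ → z′ ∉ T₂ →
    HasNbrIn G z T₁ → HasNbrIn G z′ T₁ → HasNbrIn G z′ T₂ → HasNbrIn G z T₂ → HasCycle G S
  cycle-through-two-sets {S} {z = z} {z′} T₁⊆S T₂⊆S connected₁ connected₂ T₁∩T₂=∅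
    z∈S z′∈S z≢z′ z∉T₁ z∉T₂ z′∉T₁ z′∉T₂ (t₁ , t₁∈ , z~t₁) (t₂ , t₂∈ , z′~t₂) (s₁ , s₁∈ , z′~s₁) (s₂ , s₂∈ , z~s₂)
    with walk→path (connected₁ t₁ t₂ t₁∈ t₂∈) | walk→path (connected₂ s₁ s₂ s₁∈ s₂∈)
  ... | ps , path₁@(_ , _ , inT₁ , _) | qs , path₂@(_ , _ , inT₂ , _) =
    path-close (path-cons z∈S z~t₁ z∉ around) (s≤s (1≤length ps)) (adj-sym G z~s₂)
    where
    back : Path S z′ s₂ (s₁ ∷ qs)
    back = path-cons z′∈S z′~s₁ (∉-outside z′∉T₂ inT₂) (path-mono T₂⊆S path₂)
    apart : ∀ {v} → v ∈ₗ t₁ ∷ ps → v ∉ₗ z′ ∷ s₁ ∷ qs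
    apart v∈ (here refl) = z′∉T₁ (All.lookup inT₁ v∈)
    apart v∈ (there v∈′) = T₁∩T₂=∅ (All.lookup inT₁ v∈) (All.lookup inT₂ v∈′)
    around : Path S t₁ s₂ (ps ++ z′ ∷ s₁ ∷ qs)
    around = path-join (path-mono T₁⊆S path₁) (adj-sym G z′~t₂) back apart
    z∉ : z ∉ₗ t₁ ∷ ps ++ z′ ∷ s₁ ∷ qs
    z∉ (here refl) = z∉T₁ t₁∈
    z∉ (there z∈) with ∈-++⁻ ps z∈
    ... | inj₁ z∈ps            = z∉T₁ (All.lookup inT₁ (there z∈ps))
    ... | inj₂ (here refl)     = z≢z′ refl
    ... | inj₂ (there z∈s₁∷qs) = z∉T₂ (All.lookup inT₂ z∈s₁∷qs)
    1≤length : ∀ xs → 1 ≤ length (xs ++ z′ ∷ s₁ ∷ qs)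
    1≤length []       = s≤s z≤n
    1≤length (_ ∷ _)  = s≤s z≤n

  chain-rotate : ∀ v as w bs → Chain G v ((as ++ w ∷ bs) ∷ʳ v) → Chain G w ((bs ++ v ∷ as) ∷ʳ w)
  chain-rotate v as w bs chain
    with chain-++⁻ v as (subst (Chain G v) (++-assoc as (w ∷ bs) (v ∷ [])) chain)
  ... | chain-as , (e₁ , chain-bs-v) with chain-++⁻ w bs chain-bs-v
  ... | chain-bs , (e₂ , _) =
    subst (Chain G w) (≡-sym (++-assoc bs (v ∷ as) (w ∷ [])))
      (chain-++⁺ w bs chain-bs (e₂ , chain-++⁺ v as chain-as (e₁ , tt)))

  rotate : ∀ {S v w} ws → Cycle G S v ws → w ∈ₗ v ∷ ws →
    Σ (List (Fin n)) λ ws′ → Cycle G S w ws′ × (∀ {y} → y ∈ₗ v ∷ ws → y ∈ₗ w ∷ ws′)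
  rotate ws cycle (here refl) = ws , cycle , λ y∈ → y∈
  rotate {v = v} {w} ws (long , distinct , inS , chain) (there w∈ws) with ∈-∃++ w∈ws
  ... | as , bs , refl =
    bs ++ v ∷ as ,
    (long′ , Unique-resp-↭ (↭⇒↭ₛ σ) distinct , All-resp-↭ σ inS , chain-rotate v as w bs chain) ,
    ∈-resp-↭ σ
    where
    σ : v ∷ as ++ w ∷ bs ↭ w ∷ bs ++ v ∷ as
    σ = ++-comm (v ∷ as) (w ∷ bs)
    long′ : 2 ≤ length (bs ++ v ∷ as)
    long′ = subst (2 ≤_) (ℕ.suc-injective (↭-length σ)) long

  spread : ∀ {L : Subset n} (P : Fin n → Set) → (∀ {x y} → x ∈ L → P y → adj G x y ≡ true → y ∈ L) →
    ∀ {x} ys → Chain G x ys → All P (x ∷ ys) → Any (_∈ L) (x ∷ ys) → All (_∈ L) (x ∷ ys)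
  spread P closed []       _           _                (here x∈L) = x∈L ∷ []
  spread P closed (_ ∷ ys) (e , chain) (_ ∷ py ∷ pys)   (here x∈L) =
    x∈L ∷ spread P closed ys chain (py ∷ pys) (here (closed x∈L py e))
  spread P closed (_ ∷ ys) (e , chain) (px ∷ pys)       (there meets) =
    let rest = spread P closed ys chain pys meets in closed (All.head rest) px (adj-sym G e) ∷ rest

  cycle-inside : ∀ {A L : Subset n} (P : Fin n → Set) → (∀ {x y} → x ∈ L → P y → adj G x y ≡ true → y ∈ L) →
    ∀ {v ws} → Cycle G A v ws → All P (v ∷ ws) → Any (_∈ L) (v ∷ ws) → HasCycle G L
  cycle-inside P closed {v} {ws} (long , distinct , _ , chain) (pv ∷ pws) meets =
    v , ws , long , distinct , All.head inL ∷ proj₁ (All.++⁻ ws (All.tail inL)) , chain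
    where
    extend : ∀ {L} → Any (_∈ L) (v ∷ ws) → Any (_∈ L) (v ∷ ws ∷ʳ v)
    extend (here v∈L)  = here v∈L
    extend (there w∈L) = there (Any.++⁺ˡ w∈L)
    inL = spread P closed (ws ∷ʳ v) chain (pv ∷ All.++⁺ pws (pv ∷ [])) (extend meets)

  Exit : Subset n → Subset n → Fin n → Fin n → Set
  Exit A L x y = x ∈ L × y ∈ A × y ∉ L × adj G x y ≡ true

  exit? : ∀ A L → Dec (∃ λ x → ∃ λ y → Exit A L x y)
  exit? A L = any? λ x → any? λ y → (x ∈? L) ×-dec (y ∈? A) ×-dec ¬? (y ∈? L) ×-dec (adj G x y ≟ᵇ true)

  AtMostOneExit : Subset n → Subset n → Set
  AtMostOneExit A L = ∀ {x y x′ y′} → Exit A L x y → Exit A L x′ y′ → x ≡ x′ × y ≡ y′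

  -- Suppose the only edge of G[A] leaving the acyclic set L is x₀w. Then no cycle of
  -- G[A] meets L: such a cycle would either stay inside L or pass through w, entering
  -- L from w and returning to w along two different edges.
  module _ {A L : Subset n} {x₀ w : Fin n}
      (one-exit : AtMostOneExit A L) (exit₀ : Exit A L x₀ w) where

    private
      Inner : Fin n → Set
      Inner y = y ∈ A × y ≢ w

      closed : ∀ {x y} → x ∈ L → Inner y → adj G x y ≡ true → y ∈ L
      closed {y = y} x∈L (y∈A , y≢w) e with y ∈? L
      ... | yes y∈L = y∈L
      ... | no  y∉L = contradiction (≡-sym (proj₂ (one-exit exit₀ (x∈L , y∈A , y∉L , e)))) y≢w

      ≢w : ∀ {xs} → All (w ≢_) xs → All (_≢ w) xs
      ≢w = All.map (λ w≢u → w≢u ∘′ ≡-sym)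

    cycle-misses : ¬ HasCycle G L → ∀ {v ws} → Cycle G A v ws → ¬ Any (_∈ L) (v ∷ ws)
    cycle-misses L-acyclic {v} {ws} cycle@(_ , _ , inA , _) meets with w ∈ₗ? v ∷ ws
    ... | no  w∉cycle =
      L-acyclic (cycle-inside Inner closed cycle (All.zip (inA , ≢w (All.¬Any⇒All¬ _ w∉cycle))) meets)
    ... | yes w∈cycle with rotate ws cycle w∈cycle
    ...   | [] , (() , _) , _
    ...   | _ ∷ [] , (s≤s () , _) , _
    ...   | x₁ ∷ y ∷ ys , (_ , (w≢ ∷ x₁≢ ∷ _) , (_ ∷ inA′) , (w~x₁ , chain)) , moved =
      All.lookup x₁≢ (endpoint-∈ x₁ y ys)
        (proj₁ (one-exit (All.head inL , w∈A , w∉L , adj-sym G w~x₁) (xₘ∈L , w∈A , w∉L , xₘ~w)))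
      where
      w∈A = proj₁ (proj₂ exit₀)
      w∉L = proj₁ (proj₂ (proj₂ exit₀))
      front = chain-++⁻ x₁ (y ∷ ys) chain
      xₘ~w = proj₁ (proj₂ front)
      meets′ : Any (_∈ L) (x₁ ∷ y ∷ ys)
      meets′ with find meets
      ... | u , u∈ , u∈L with moved u∈
      ...   | here refl = contradiction u∈L w∉L
      ...   | there u∈′ = lose u∈′ u∈L
      inL = spread Inner closed (y ∷ ys) (proj₁ front) (All.zip (inA′ , ≢w w≢)) meets′
      xₘ∈L = All.lookup (All.tail inL) (endpoint-∈ x₁ y ys)

  cycle-avoids : ∀ {A L} → ¬ HasCycle G L → AtMostOneExit A L → HasCycle G A → HasCycle G (A ─ L)
  cycle-avoids {A} {L} L-acyclic one-exit (v , ws , cycle@(long , distinct , inA , chain))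
    with Any.any? (_∈? L) (v ∷ ws)
  ... | no  misses = v , ws , long , distinct , All.zipWith (λ (a , b) → x∈p∧x∉q⇒x∈p─q a b) (inA , All.¬Any⇒All¬ _ misses) , chain
  ... | yes meets with exit? A L
  ...   | yes (_ , _ , exit) = contradiction meets (cycle-misses one-exit exit L-acyclic cycle)
  ...   | no  no-exit        = contradiction (cycle-inside (_∈ A) closed cycle inA meets) L-acyclic
    where
    closed : ∀ {x y} → x ∈ L → y ∈ A → adj G x y ≡ true → y ∈ L
    closed {x} {y} x∈L y∈A e with y ∈? L
    ... | yes y∈L = y∈L
    ... | no  y∉L = contradiction (x , y , x∈L , y∈A , y∉L , e) no-exit

-- Counting: among pairwise disjoint sets U₀, …, U_{N-1}, at most ∣ Y ∣ meet Y, since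
-- each of them contains its own element of Y.
avoiders : ∀ {n} N (U : Fin N → Subset n) (Y : Subset n) → (∀ i j {x} → x ∈ U i → x ∈ U j → i ≡ j) →
  Σ (List (Fin N)) λ is → Unique is × All (λ i → Disjoint (U i) Y) is × N ≤ length is + ∣ Y ∣
avoiders zero    U Y _        = [] , [] , [] , z≤n
avoiders (suc N) U Y disjoint with any? (λ x → (x ∈? U zero) ×-dec (x ∈? Y))
... | no U₀∩Y=∅ =
  zero ∷ map suc is ,
  All.map⁺ (All.tabulate (λ _ ())) ∷ Unique.map⁺ suc-injective distinct ,
  (λ x∈U₀ x∈Y → U₀∩Y=∅ (_ , x∈U₀ , x∈Y)) ∷ All.map⁺ avoid ,
  s≤s (subst (λ l → N ≤ l + ∣ Y ∣) (≡-sym (length-map suc is)) long)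
  where
  open Σ (avoiders N (U ∘′ suc) Y (λ i j x∈ x∈′ → suc-injective (disjoint (suc i) (suc j) x∈ x∈′)))
    renaming (proj₁ to is; proj₂ to properties)
  distinct = proj₁ properties
  avoid = proj₁ (proj₂ properties)
  long = proj₂ (proj₂ properties)
... | yes (y , y∈U₀ , y∈Y) =
  map suc is ,
  Unique.map⁺ suc-injective distinct ,
  All.map⁺ (All.map avoid-Y avoid) ,
  subst (λ l → suc N ≤ l + ∣ Y ∣) (≡-sym (length-map suc is))
    (ℕ.≤-trans (s≤s long) (ℕ.≤-trans (ℕ.≤-reflexive (≡-sym (ℕ.+-suc _ _))) (ℕ.+-monoʳ-≤ (length is) (x∈p⇒∣p-x∣<∣p∣ y∈Y))))
  where
  -- the other sets avoid Y iff they avoid Y - y, as y already lies in U₀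
  open Σ (avoiders N (U ∘′ suc) (Y - y) (λ i j x∈ x∈′ → suc-injective (disjoint (suc i) (suc j) x∈ x∈′)))
    renaming (proj₁ to is; proj₂ to properties)
  distinct = proj₁ properties
  avoid = proj₁ (proj₂ properties)
  long = proj₂ (proj₂ properties)
  avoid-Y : ∀ {i} → Disjoint (U (suc i)) (Y - y) → Disjoint (U (suc i)) Y
  avoid-Y {i} U∩Y-y=∅ {x} x∈U x∈Y with x ≟ᶠ y
  ... | yes refl = contradiction (disjoint zero (suc i) y∈U₀ x∈U) (λ ())
  ... | no  x≢y  = U∩Y-y=∅ x∈U (x∈p∧x≢y⇒x∈p-y x∈Y x≢y)

two-avoiders : ∀ {n} m (U : Fin (2 + m) → Subset n) (Y : Subset n) →
  (∀ i j {x} → x ∈ U i → x ∈ U j → i ≡ j) → ∣ Y ∣ ≤ m →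
  ∃ λ a → ∃ λ b → a ≢ b × Disjoint (U a) Y × Disjoint (U b) Y
two-avoiders m U Y disjoint ∣Y∣≤m with avoiders (2 + m) U Y disjoint
... | a ∷ b ∷ _ , ((a≢b ∷ _) ∷ _) , (U-a ∷ U-b ∷ _) , _ = a , b , a≢b , U-a , U-b
... | [] , _ , _ , 2+m≤∣Y∣ =
  contradiction (ℕ.≤-trans (ℕ.n≤1+n _) (ℕ.≤-trans 2+m≤∣Y∣ ∣Y∣≤m)) ℕ.1+n≰n
... | _ ∷ [] , _ , _ , 2+m≤1+∣Y∣ =
  contradiction (ℕ.≤-pred (ℕ.≤-trans 2+m≤1+∣Y∣ (s≤s ∣Y∣≤m))) ℕ.1+n≰n

-- The reduction: T (fromℕ (2 + k + d)) is the tree L that gets deleted; the other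
-- trees T (inject₁ i), i < k + d + 2, are the spare copies used in the backward direction.
module Reduction (d : ℕ) {n : ℕ} (G : Graph n) (Z : Subset n) (k : ℕ)
  (T : Fin (3 + k + d) → Subset n) (T-injective : Injective _≡_ _≡_ T)
  (T-component : ∀ i → IsComponent G (∁ Z) (T i)) (T-tree : ∀ i → IsTree G (T i))
  (T-type : ∀ i j → SameNbhdType G Z (T i) (T j)) where

  L : Subset n
  L = T (fromℕ (2 + k + d))

  T-disjoint : ∀ i j {x} → x ∈ T i → x ∈ T j → i ≡ j
  T-disjoint i j x∈Tᵢ x∈Tⱼ = T-injective (⊆-antisym
    (component-⊆-component G (T-component i) (T-component j) x∈Tᵢ x∈Tⱼ)
    (component-⊆-component G (T-component j) (T-component i) x∈Tⱼ x∈Tᵢ))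

  T∩Z=∅ : ∀ i → Disjoint (T i) Z
  T∩Z=∅ i x∈T = x∈∁p⇒x∉p (component-⊆ G (T-component i) x∈T)

  T-connected : ∀ i → Connected G (T i)
  T-connected i = proj₁ (proj₂ (T-tree i))

  L-acyclic : ¬ HasCycle G L
  L-acyclic = proj₂ (proj₂ (T-tree _))

  L-closed : ∀ {x y} → x ∈ L → y ∉ Z → adj G x y ≡ true → y ∈ L
  L-closed x∈L y∉Z e = component-closed G (T-component _) x∈L (x∉p⇒x∈∁p y∉Z) e

  sees-every-tree : ∀ i {u} → u ∈ Z → HasNbrIn G u L → HasNbrIn G u (T i)
  sees-every-tree i u∈Z = Equivalence.to (proj₁ (T-type _ i) _ u∈Z)

  one-edge-from-tree : ∀ i {u} → u ∈ Z → HasNbrIn G u L → edgesTo G u (T i) ≡ 1 → edgesTo G u L ≡ 1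
  one-edge-from-tree i u∈Z u~L = Equivalence.from (proj₂ (T-type _ i) _ u∈Z u~L)

  forward : YesInstance d G ⊤ Z k → YesInstance d G (⊤ ─ L) Z k
  forward (X , _ , ∣X∣≤k , X∩Z=∅ , qf) =
    X ─ L ,
    (λ x∈ → x∈p∧x∉q⇒x∈p─q ∈⊤ (proj₂ (x∈p─q⁻ X L x∈))) ,
    ℕ.≤-trans (∣p─q∣≤∣p∣ X L) ∣X∣≤k ,
    (λ x x∈ → X∩Z=∅ x (proj₁ (x∈p─q⁻ X L x∈))) ,
    quasiForest-mono G shrink qf
    where
    shrink : (⊤ ─ L) ─ (X ─ L) ⊆ ⊤ ─ X
    shrink v∈ with x∈p─q⁻ (⊤ ─ L) _ v∈
    ... | v∈⊤─L , v∉X─L = x∈p∧x∉q⇒x∈p─q ∈⊤ (λ v∈X → v∉X─L (x∈p∧x∉q⇒x∈p─q v∈X (proj₂ (x∈p─q⁻ ⊤ L v∈⊤─L))))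

  module Backward (X : Subset n) (X⊆ : X ⊆ ⊤ ─ L) (∣X∣≤k : ∣ X ∣ ≤ k)
      (X∩Z=∅ : ∀ x → x ∈ X → x ∉ Z) (qf′ : QuasiForest d G ((⊤ ─ L) ─ X)) where

    A A′ : Subset n
    A  = ⊤ ─ X
    A′ = (⊤ ─ L) ─ X

    X∩L=∅ : Disjoint X L
    X∩L=∅ x∈X = proj₂ (x∈p─q⁻ ⊤ L (X⊆ x∈X))

    A′⊆A : A′ ⊆ A
    A′⊆A v∈ = x∈p∧x∉q⇒x∈p─q ∈⊤ (proj₂ (x∈p─q⁻ (⊤ ─ L) X v∈))

    L⊆A : L ⊆ A
    L⊆A v∈L = x∈p∧x∉q⇒x∈p─q ∈⊤ (λ v∈X → X∩L=∅ v∈X v∈L)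

    A─L⊆A′ : ∀ {v} → v ∈ A → v ∉ L → v ∈ A′
    A─L⊆A′ v∈A v∉L = x∈p∧x∉q⇒x∈p─q (x∈p∧x∉q⇒x∈p─q ∈⊤ v∉L) (proj₂ (x∈p─q⁻ ⊤ X v∈A))

    Z⊆A′ : ∀ {u} → u ∈ Z → u ∈ A′
    Z⊆A′ {u} u∈Z = A─L⊆A′ (x∈p∧x∉q⇒x∈p─q ∈⊤ (λ u∈X → X∩Z=∅ u u∈X u∈Z)) (λ u∈L → T∩Z=∅ _ u∈L u∈Z)

    module Meeting (C : Subset n) (C-comp : IsComponent G A C) {c} (c∈C : c ∈ C) (c∈L : c ∈ L) where

      L⊆C : L ⊆ C
      L⊆C {v} v∈L = walk-in-component G C-comp L⊆A c∈C (T-connected _ c v c∈L v∈L)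

      isolated : ¬ (∃ λ u → u ∈ Z × HasNbrIn G u L) → Σ (Subset n) λ F → IsFVS G C F × ∣ F ∣ ≤ d
      isolated unseen = ∅ , ((λ v∈∅ → contradiction v∈∅ ∉⊥) , C-acyclic) , ℕ.≤-trans (ℕ.≤-reflexive (∣⊥∣≡0 n)) z≤n
        where
        stays-in-L : ∀ {p v} → p ∈ L → Walk G C p v → v ∈ L
        stays-in-L p∈L (here _) = p∈L
        stays-in-L {p} p∈L (step {w = w} _ e walk) with w ∈? Z
        ... | yes w∈Z = contradiction (w , w∈Z , p , p∈L , adj-sym G e) unseen
        ... | no  w∉Z = stays-in-L (L-closed p∈L w∉Z e) walk
        C─∅⊆L : C ─ ∅ ⊆ L
        C─∅⊆L {v} v∈ = stays-in-L c∈L (component-connected G C-comp c v c∈C (proj₁ (x∈p─q⁻ C ∅ v∈)))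
        C-acyclic : ¬ HasCycle G (C ─ ∅)
        C-acyclic cycle = L-acyclic (hasCycle-mono G C─∅⊆L cycle)

      module Attached {u₀} (u₀∈Z : u₀ ∈ Z) (u₀~L : HasNbrIn G u₀ L) where

        enclosing = component-of G A′ u₀ (Z⊆A′ u₀∈Z)
        C′ = proj₁ enclosing
        C′-comp = proj₁ (proj₂ enclosing)
        u₀∈C′ = proj₂ (proj₂ enclosing)

        fvs′ = qf′ C′ C′-comp
        F′ = proj₁ fvs′
        F′⊆C′ = proj₁ (proj₁ (proj₂ fvs′))
        C′─F′-acyclic = proj₂ (proj₁ (proj₂ fvs′))
        ∣F′∣≤d = proj₂ (proj₂ fvs′)

        U : Fin (2 + k + d) → Subset n
        U i = T (inject₁ i)

        U-disjoint : ∀ i j {x} → x ∈ U i → x ∈ U j → i ≡ j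
        U-disjoint i j x∈ x∈′ = inject₁-injective (T-disjoint (inject₁ i) (inject₁ j) x∈ x∈′)

        U∩L=∅ : ∀ i → Disjoint (U i) L
        U∩L=∅ i x∈U x∈L = fromℕ≢inject₁ (≡-sym (T-disjoint (inject₁ i) _ x∈U x∈L))

        Y = X ∪ F′
        clean = two-avoiders (k + d) U Y U-disjoint
                  (ℕ.≤-trans (∣p∪q∣≤∣p∣+∣q∣ X F′) (ℕ.+-mono-≤ ∣X∣≤k ∣F′∣≤d))
        a = proj₁ clean
        b = proj₁ (proj₂ clean)
        a≢b = proj₁ (proj₂ (proj₂ clean))
        Uₐ∩Y=∅ = proj₁ (proj₂ (proj₂ (proj₂ clean)))
        U_b∩Y=∅ = proj₂ (proj₂ (proj₂ (proj₂ clean)))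

        -- A spare tree avoiding X ∪ F′ lies in C′ − F′, since u₀ sees it.
        clean⊆A′ : ∀ {i} → Disjoint (U i) Y → U i ⊆ A′
        clean⊆A′ {i} Uᵢ∩Y=∅ x∈U =
          A─L⊆A′ (x∈p∧x∉q⇒x∈p─q ∈⊤ (λ x∈X → Uᵢ∩Y=∅ x∈U (x∈p∪q⁺ (inj₁ x∈X)))) (U∩L=∅ i x∈U)

        clean⊆C′─F′ : ∀ {i} → Disjoint (U i) Y → U i ⊆ C′ ─ F′
        clean⊆C′─F′ {i} Uᵢ∩Y=∅ {v} v∈U with sees-every-tree (inject₁ i) u₀∈Z u₀~L
        ... | t , t∈U , u₀~t = x∈p∧x∉q⇒x∈p─q v∈C′ (λ v∈F′ → Uᵢ∩Y=∅ v∈U (x∈p∪q⁺ (inj₂ v∈F′)))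
          where
          t∈C′ = component-closed G C′-comp u₀∈C′ (clean⊆A′ Uᵢ∩Y=∅ t∈U) u₀~t
          v∈C′ = walk-in-component G C′-comp (clean⊆A′ Uᵢ∩Y=∅) t∈C′ (T-connected _ t v t∈U v∈U)

        -- Every vertex of Z seeing L sees the clean tree U a, hence lies in C′.
        sees-L⇒∈C′ : ∀ {u} → u ∈ Z → HasNbrIn G u L → u ∈ C′
        sees-L⇒∈C′ u∈Z u~L with sees-every-tree (inject₁ a) u∈Z u~L
        ... | t , t∈U , u~t =
          component-closed G C′-comp (proj₁ (x∈p─q⁻ C′ F′ (clean⊆C′─F′ Uₐ∩Y=∅ t∈U))) (Z⊆A′ u∈Z) (adj-sym G u~t)

        C′⊆C : C′ ⊆ C
        C′⊆C {v} v∈C′ =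
          walk-in-component G C-comp (A′⊆A ∘′ component-⊆ G C′-comp) u₀∈C
            (component-connected G C′-comp u₀ v u₀∈C′ v∈C′)
          where
          u₀∈C = component-closed G C-comp (L⊆C (proj₁ (proj₂ u₀~L))) (A′⊆A (Z⊆A′ u₀∈Z))
                   (adj-sym G (proj₂ (proj₂ u₀~L)))

        -- C is covered by C′ and L: a walk from u₀ never leaves C′ ∪ L.
        C⊆C′∪L : ∀ {v} → v ∈ C → v ∈ C′ ⊎ v ∈ L
        C⊆C′∪L {v} v∈C = stays (inj₁ u₀∈C′) (component-connected G C-comp u₀ v (C′⊆C u₀∈C′) v∈C)
          where
          stays : ∀ {p v} → p ∈ C′ ⊎ p ∈ L → Walk G C p v → v ∈ C′ ⊎ v ∈ L
          stays p∈ (here _) = p∈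
          stays (inj₁ p∈C′) (step {w = w} _ e walk) with w ∈? L
          ... | yes w∈L = stays (inj₂ w∈L) walk
          ... | no  w∉L = stays (inj₁ (component-closed G C′-comp p∈C′
                            (A─L⊆A′ (component-⊆ G C-comp (walk-start G walk)) w∉L) e)) walk
          stays {p} (inj₂ p∈L) (step {w = w} _ e walk) with w ∈? Z
          ... | yes w∈Z = stays (inj₁ (sees-L⇒∈C′ w∈Z (p , p∈L , adj-sym G e))) walk
          ... | no  w∉Z = stays (inj₂ (L-closed p∈L w∉Z e)) walk

        ∈C′─F′ : ∀ {u} → u ∈ Z → u ∉ F′ → HasNbrIn G u L → u ∈ C′ ─ F′
        ∈C′─F′ u∈Z u∉F′ u~L = x∈p∧x∉q⇒x∈p─q (sees-L⇒∈C′ u∈Z u~L) u∉F′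

        Uₐ∩U_b=∅ : Disjoint (U a) (U b)
        Uₐ∩U_b=∅ x∈Uₐ x∈U_b = a≢b (U-disjoint a b x∈Uₐ x∈U_b)

        -- At most one vertex of Z − F′ sees L: two of them would close a cycle
        -- through the clean trees U a and U b inside C′ − F′.
        one-connector : ∀ {z z′} → z ∈ Z → z′ ∈ Z → z ∉ F′ → z′ ∉ F′ →
          HasNbrIn G z L → HasNbrIn G z′ L → z ≡ z′
        one-connector {z} {z′} z∈Z z′∈Z z∉F′ z′∉F′ z~L z′~L with z ≟ᶠ z′
        ... | yes z≡z′ = z≡z′
        ... | no  z≢z′ = contradiction
          (cycle-through-two-sets G (clean⊆C′─F′ Uₐ∩Y=∅) (clean⊆C′─F′ U_b∩Y=∅)
            (T-connected _) (T-connected _) Uₐ∩U_b=∅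
            (∈C′─F′ z∈Z z∉F′ z~L) (∈C′─F′ z′∈Z z′∉F′ z′~L) z≢z′
            (Z∉T z∈Z) (Z∉T z∈Z) (Z∉T z′∈Z) (Z∉T z′∈Z)
            (sees-every-tree (inject₁ a) z∈Z z~L) (sees-every-tree (inject₁ a) z′∈Z z′~L)
            (sees-every-tree (inject₁ b) z′∈Z z′~L) (sees-every-tree (inject₁ b) z∈Z z~L))
          C′─F′-acyclic
          where
          Z∉T : ∀ {u i} → u ∈ Z → u ∉ T i
          Z∉T u∈Z u∈T = T∩Z=∅ _ u∈T u∈Z

        not-one-edge : ∀ {z x x′} → z ∈ Z → x ∈ L → x′ ∈ L → x ≢ x′ →
          adj G z x ≡ true → adj G z x′ ≡ true → edgesTo G z (U a) ≢ 1
        not-one-edge z∈Z x∈L x′∈L x≢x′ z~x z~x′ one =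
          x≢x′ (one-edge⇒one-neighbour G (one-edge-from-tree (inject₁ a) z∈Z (_ , x∈L , z~x) one)
                  x∈L x′∈L z~x z~x′)

        -- A vertex of Z − F′ has a single neighbour in L: otherwise it has two
        -- neighbours in the clean tree U a as well, closing a cycle inside C′ − F′.
        one-edge : ∀ {z x x′} → z ∈ Z → z ∉ F′ → x ∈ L → x′ ∈ L →
          adj G z x ≡ true → adj G z x′ ≡ true → x ≡ x′
        one-edge {x = x} {x′} z∈Z z∉F′ x∈L x′∈L z~x z~x′ with x ≟ᶠ x′
        ... | yes x≡x′ = x≡x′
        ... | no  x≢x′ with sees-every-tree (inject₁ a) z∈Z (x , x∈L , z~x)
        ...   | t , t∈U , z~t with another-neighbour G t∈U z~t (not-one-edge z∈Z x∈L x′∈L x≢x′ z~x z~x′)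
        ...     | t′ , (t′∈U , z~t′) , t′≢t = contradiction
          (cycle-through-vertex G (clean⊆C′─F′ Uₐ∩Y=∅) (T-connected _) (∈C′─F′ z∈Z z∉F′ (x , x∈L , z~x))
            (λ z∈U → T∩Z=∅ _ z∈U z∈Z) t′∈U t∈U t′≢t z~t′ z~t)
          C′─F′-acyclic

        exit∈Z : ∀ {x y} → x ∈ L → y ∉ L → adj G x y ≡ true → y ∈ Z
        exit∈Z x∈L y∉L e with _ ∈? Z
        ... | yes y∈Z = y∈Z
        ... | no  y∉Z = contradiction (L-closed x∈L y∉Z e) y∉L

        one-exit : AtMostOneExit G (C ─ F′) L
        one-exit (x∈L , y∈ , y∉L , x~y) (x′∈L , y′∈ , y′∉L , x′~y′)
          with one-connector (exit∈Z x∈L y∉L x~y) (exit∈Z x′∈L y′∉L x′~y′)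
                 (proj₂ (x∈p─q⁻ C F′ y∈)) (proj₂ (x∈p─q⁻ C F′ y′∈))
                 (_ , x∈L , adj-sym G x~y) (_ , x′∈L , adj-sym G x′~y′)
        ... | refl = one-edge (exit∈Z x∈L y∉L x~y) (proj₂ (x∈p─q⁻ C F′ y∈)) x∈L x′∈L
                       (adj-sym G x~y) (adj-sym G x′~y′) , refl

        C─F′─L⊆C′─F′ : (C ─ F′) ─ L ⊆ C′ ─ F′
        C─F′─L⊆C′─F′ v∈ with x∈p─q⁻ (C ─ F′) L v∈
        ... | v∈C─F′ , v∉L with x∈p─q⁻ C F′ v∈C─F′
        ...   | v∈C , v∉F′ with C⊆C′∪L v∈C
        ...     | inj₁ v∈C′ = x∈p∧x∉q⇒x∈p─q v∈C′ v∉F′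
        ...     | inj₂ v∈L  = contradiction v∈L v∉L

        fvs : Σ (Subset n) λ F → IsFVS G C F × ∣ F ∣ ≤ d
        fvs = F′ , (C′⊆C ∘′ F′⊆C′ , C─F′-acyclic) , ∣F′∣≤d
          where
          C─F′-acyclic : ¬ HasCycle G (C ─ F′)
          C─F′-acyclic cycle =
            C′─F′-acyclic (hasCycle-mono G C─F′─L⊆C′─F′ (cycle-avoids G L-acyclic one-exit cycle))

    -- Every component C of G − X has a feedback vertex set of size ≤ d: if C misses L
    -- it is a component of G − L − X, otherwise one of the two cases above applies.
    quasiForest : QuasiForest d G A
    quasiForest C C-comp with any? (λ x → (x ∈? C) ×-dec (x ∈? L))
    ... | yes (c , c∈C , c∈L) with any? (λ u → (u ∈? Z) ×-dec hasNbr? G u L)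
    ...   | yes (u₀ , u₀∈Z , u₀~L) = Meeting.Attached.fvs C C-comp c∈C c∈L u₀∈Z u₀~L
    ...   | no  unseen             = Meeting.isolated C C-comp c∈C c∈L unseen
    quasiForest C (C⊆A , nonempty , connected , closed) | no misses =
      qf′ C ((λ v∈C → A─L⊆A′ (C⊆A v∈C) (λ v∈L → misses (_ , v∈C , v∈L))) ,
             nonempty , connected , λ u w u∈C w∈A′ → closed u w u∈C (A′⊆A w∈A′))

  backward : YesInstance d G (⊤ ─ L) Z k → YesInstance d G ⊤ Z k
  backward (X , X⊆ , ∣X∣≤k , X∩Z=∅ , qf′) =
    X , (λ _ → ∈⊤) , ∣X∣≤k , X∩Z=∅ , Backward.quasiForest X X⊆ ∣X∣≤k X∩Z=∅ qf′

lemma8 : ∀ (d : ℕ) {n : ℕ} (G : Graph n) (Z : Subset n) (k : ℕ) →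
    IsInstance d G ⊤ Z k →
    (T : Fin (3 + k + d) → Subset n) →
    Injective _≡_ _≡_ T →
    (∀ i → IsComponent G (∁ Z) (T i)) →
    (∀ i → IsTree G (T i)) →
    (∀ i j → SameNbhdType G Z (T i) (T j)) →
    YesInstance d G ⊤ Z k ⇔ YesInstance d G (⊤ ─ T (fromℕ (2 + k + d))) Z k
lemma8 d G Z k _ T T-injective T-component T-tree T-type = mk⇔ forward backward
  where open Reduction d G Z k T T-injective T-component T-tree T-type
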